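{- Every suspension expression that is well-formed (in the sense defined in the context) is also well-formed in the original sense, i.e., every subexpression of it satisfies: if it is $[\![t,ol,nl,e]\!]$ then $len(e)=ol$ and $ind(e)\le nl$; if it is $(t,l)::e$ then $l\ge ind(e)$; if it is $\{\!\{e_1,nl_1,ol_2,e_2\}\!\}$ then $ind(e_1)\le nl_1$ and $len(e_2)=ol_2$.
   Context: Suspension expressions: terms $t ::= c \mid \#i \mid (t\ t) \mid (\lambda\, t) \mid [\![t,n,n,e]\!]$ and environments $e ::= nil \mid ((t,n)::e) \mid \{\!\{e,n,n,e\}\!\}$, with $c$ constants, $n$ natural numbers, $i$ positive integers. Write $m\mathbin{\dot- } n=\max(m-n,0)$. Length: $len(nil)=0$, $len((t,l)::e)=1+len(e)$, $len(\{\!\{e_1,nl_1,ol_2,e_2\}\!\}) = len(e_1)+(len(e_2)\mathbin{\dot- } nl_1)$. Level: $lev(nil)=0$, $lev((t,l)::e)=l$, $lev(\{\!\{e_1,nl_1,ol_2,e_2\}\!\})=lev(e_2)+(nl_1\mathbin{\dot- } ol_2)$. Well-formed: every subexpression satisfies: $[\![t,ol,nl,e]\!]$ has $len(e)=ol$ and $lev(e)\le nl$; $(t,l)::e$ has $l\ge lev(e)$; $\{\!\{e_1,nl_1,ol_2,e_2\}\!\}$ has $lev(e_1)\le nl_1$ and $len(e_2)=ol_2$. Index: for a natural number $i$, $ind_i(nil)=0$; $ind_i((t,k)::e')$ is $k$ if $i=0$ and $ind_{i-1}(e')$ otherwise; for $e=\{\!\{e_1,nl,ol,e_2\}\!\}$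 let $m = nl\mathbin{\dot- } ind_i(e_1)$ and $l=len(e_1)$; then $ind_i(e) = ind_m(e_2)+(nl\mathbin{\dot- } ol)$ if $i<l$ and $len(e_2)>m$; $ind_i(e)=ind_i(e_1)$ if $i<l$ and $len(e_2)\le m$; $ind_i(e)=ind_{i-l+nl}(e_2)$ if $i\ge l$. Finally $ind(e)=ind_0(e)$. -}

module Defs where

open import Data.Nat using (ℕ; zero; suc; _+_; _∸_; _≤_; _<_; NonZero)
open import Data.Nat using (_<ᵇ_; _≤ᵇ_)
open import Data.Bool using (if_then_else_)
open import Relation.Binary.PropositionalEquality using (_≡_)

-- Suspension expressions: terms and environments (mutually defined).
-- Constants are named by natural numbers; de Bruijn indices #i are positive.
data Term : Set
data Env : Set

data Term where
  const : ℕ → Term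
  var   : (i : ℕ) → .{{NonZero i}} → Term
  app   : Term → Term → Term
  lam   : Term → Term
  susp  : Term → ℕ → ℕ → Env → Term

data Env where
  nil  : Env
  cons : Term → ℕ → Env → Env
  comp : Env → ℕ → ℕ → Env → Env

len : Env → ℕ
len nil = 0
len (cons t l e) = suc (len e)
len (comp e₁ nl₁ ol₂ e₂) = len e₁ + (len e₂ ∸ nl₁)

lev : Env → ℕ
lev nil = 0
lev (cons t l e) = l
lev (comp e₁ nl₁ ol₂ e₂) = lev e₂ + (nl₁ ∸ ol₂)

indAt : ℕ → Env → ℕ
indAt i nil = 0
indAt zero (cons t k e) = k
indAt (suc i) (cons t k e) = indAt i e
indAt i (comp e₁ nl ol e₂) =
  if i <ᵇ len e₁
  then (if m <ᵇ len e₂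
        then indAt m e₂ + (nl ∸ ol)
        else indAt i e₁)
  else indAt (i ∸ len e₁ + nl) e₂
  where m = nl ∸ indAt i e₁

ind : Env → ℕ
ind e = indAt 0 e

data WfT : Term → Set
data WfE : Env → Set

data WfT where
  wf-const : ∀ {c} → WfT (const c)
  wf-var   : ∀ {i} .{{_ : NonZero i}} → WfT (var i)
  wf-app   : ∀ {t₁ t₂} → WfT t₁ → WfT t₂ → WfT (app t₁ t₂)
  wf-lam   : ∀ {t} → WfT t → WfT (lam t)
  wf-susp  : ∀ {t ol nl e} → WfT t → WfE e →
             len e ≡ ol → lev e ≤ nl → WfT (susp t ol nl e)

data WfE where
  wf-nil  : WfE nil
  wf-cons : ∀ {t l e} → WfT t → WfE e → lev e ≤ l → WfE (cons t l e)
  wf-comp : ∀ {e₁ nl₁ ol₂ e₂} → WfE e₁ → WfE e₂ →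
            lev e₁ ≤ nl₁ → len e₂ ≡ ol₂ → WfE (comp e₁ nl₁ ol₂ e₂)

data OWfT : Term → Set
data OWfE : Env → Set

data OWfT where
  owf-const : ∀ {c} → OWfT (const c)
  owf-var   : ∀ {i} .{{_ : NonZero i}} → OWfT (var i)
  owf-app   : ∀ {t₁ t₂} → OWfT t₁ → OWfT t₂ → OWfT (app t₁ t₂)
  owf-lam   : ∀ {t} → OWfT t → OWfT (lam t)
  owf-susp  : ∀ {t ol nl e} → OWfT t → OWfE e →
              len e ≡ ol → ind e ≤ nl → OWfT (susp t ol nl e)

data OWfE where
  owf-nil  : OWfE nil
  owf-cons : ∀ {t l e} → OWfT t → OWfE e → ind e ≤ l → OWfE (cons t l e)
  owf-comp : ∀ {e₁ nl₁ ol₂ e₂} → OWfE e₁ → OWfE e₂ →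
             ind e₁ ≤ nl₁ → len e₂ ≡ ol₂ → OWfE (comp e₁ nl₁ ol₂ e₂)

-- Every index of a level-well-formed environment is bounded by its level, so each
-- condition ind(e) ≤ n of the original sense follows from the condition lev(e) ≤ n.
module Submission where

open import Defs
open import Data.Bool using (true; false; T)
open import Data.Nat using (ℕ; zero; suc; _+_; _∸_; _≤_; _<ᵇ_; z≤n)
open import Data.Nat.Properties
  using (≤-refl; ≤-trans; m≤m+n; m≤n+m; +-monoˡ-≤; +-comm; ≮⇒≥; <⇒<ᵇ; m+n≤o⇒m≤o∸n; m≤o∸n⇒m+n≤o)
open import Data.Product using (_×_; _,_)
open import Relation.Binary.PropositionalEquality using (_≡_; subst)

<ᵇ≡false⇒≥ : ∀ {m n} → (m <ᵇ n) ≡ false → n ≤ m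
<ᵇ≡false⇒≥ m<ᵇn≡false = ≮⇒≥ (λ m<n → subst T m<ᵇn≡false (<⇒<ᵇ m<n))

m≤o⇒n≤o∸m⇒m≤o∸n : ∀ {m n o} → m ≤ o → n ≤ o ∸ m → m ≤ o ∸ n
m≤o⇒n≤o∸m⇒m≤o∸n {m} {n} {o} m≤o n≤o∸m =
  m+n≤o⇒m≤o∸n m (subst (_≤ o) (+-comm n m) (m≤o∸n⇒m+n≤o n m≤o n≤o∸m))

indAt≤lev : ∀ {e} → WfE e → ∀ i → indAt i e ≤ lev e
indAt≤lev wf-nil i = z≤n
indAt≤lev (wf-cons _ _ _) zero = ≤-refl
indAt≤lev (wf-cons _ we lev≤l) (suc i) = ≤-trans (indAt≤lev we i) lev≤l
indAt≤lev {comp e₁ nl ol e₂} (wf-comp w₁ w₂ lev₁≤nl len₂≡ol) i with i <ᵇ len e₁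
... | false = ≤-trans (indAt≤lev w₂ _) (m≤m+n _ _)
... | true with (nl ∸ indAt i e₁) <ᵇ len e₂ in outside-e₂
...   | true = +-monoˡ-≤ (nl ∸ ol) (indAt≤lev w₂ _)
-- Here ind_i(e) = ind_i(e₁), and len(e₂) ≤ nl ∸ ind_i(e₁) gives ind_i(e₁) ≤ nl ∸ ol.
...   | false = ≤-trans (m≤o⇒n≤o∸m⇒m≤o∸n ind₁≤nl ol≤nl∸ind₁) (m≤n+m _ _)
  where
  ind₁≤nl : indAt i e₁ ≤ nl
  ind₁≤nl = ≤-trans (indAt≤lev w₁ i) lev₁≤nl
  ol≤nl∸ind₁ : ol ≤ nl ∸ indAt i e₁
  ol≤nl∸ind₁ = subst (_≤ _) len₂≡ol (<ᵇ≡false⇒≥ outside-e₂)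

ind≤lev : ∀ {e} → WfE e → ind e ≤ lev e
ind≤lev we = indAt≤lev we 0

mutual
  WfT⇒OWfT : ∀ {t} → WfT t → OWfT t
  WfT⇒OWfT wf-const = owf-const
  WfT⇒OWfT (wf-var {{i≢0}}) = owf-var {{i≢0}}
  WfT⇒OWfT (wf-app w₁ w₂) = owf-app (WfT⇒OWfT w₁) (WfT⇒OWfT w₂)
  WfT⇒OWfT (wf-lam w) = owf-lam (WfT⇒OWfT w)
  WfT⇒OWfT (wf-susp wt we len≡ol lev≤nl) =
    owf-susp (WfT⇒OWfT wt) (WfE⇒OWfE we) len≡ol (≤-trans (ind≤lev we) lev≤nl)

  WfE⇒OWfE : ∀ {e} → WfE e → OWfE e
  WfE⇒OWfE wf-nil = owf-nil
  WfE⇒OWfE (wf-cons wt we lev≤l) =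
    owf-cons (WfT⇒OWfT wt) (WfE⇒OWfE we) (≤-trans (ind≤lev we) lev≤l)
  WfE⇒OWfE (wf-comp w₁ w₂ lev₁≤nl len₂≡ol) =
    owf-comp (WfE⇒OWfE w₁) (WfE⇒OWfE w₂) (≤-trans (ind≤lev w₁) lev₁≤nl) len₂≡ol

lemma2p8 : (∀ (t : Term) → WfT t → OWfT t) × (∀ (e : Env) → WfE e → OWfE e)
lemma2p8 = (λ _ → WfT⇒OWfT) , (λ _ → WfE⇒OWfE)
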